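{- Let $\mathcal{D}=(\mathcal{P},\mathcal{B})$ be a nontrivial $2$-$(v,k,\lambda)$ design with $r$ blocks through each point, admitting a flag-transitive point-imprimitive group $G$ of automorphisms which leaves invariant a nontrivial partition $\mathcal{C}$ of $\mathcal{P}$ into $d$ parts of size $c$. Then the non-empty intersections $B\cap\Delta$ with $B\in\mathcal{B}$, $\Delta\in\mathcal{C}$ all have the same size $\ell$. Moreover the integer $x=k-1-d(\ell-1)$ is positive, and: (i) $\lambda\geq 2$; (ii) $\ell\mid k$ and $1<\ell<k$; (iii) $\lambda(c-1)=r(\ell-1)$; (iv) $k=xc+\ell$; (v) $rx=\lambda(d-1)$; (vi) $k$ divides $\frac{\lambda c(c-1)(k-(x+1))}{(\ell-1)^2}$; in particular if $\ell=2$ then $k\mid \lambda c(c-1)(x+1)$; (vii) $k\mid \lambda\ell(x+1)(x+\ell)$; (viii) $x(\ell-1)\leq\lambda-1$; (ix) $c\geq \frac{\lambda+\ell(\ell-1)}{\lambda-x(\ell-1)}$; (x) $k\geq\frac{\lambda(x+\ell)}{\lambda-x(\ell-1)}$.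
   Context: A $2$-$(v,k,\lambda)$ design has $v$ points and blocks that are $k$-subsets such that every pair of distinct points lies in exactly $\lambda$ blocks; nontrivial means $2<k<v$. Every point lies in a constant number $r$ of blocks. A flag is an incident point-block pair; flag-transitive means transitive on flags; a partition of $\mathcal{P}$ is nontrivial if it is neither the partition into singletons nor $\{\mathcal{P}\}$, and $G$ leaves it invariant if each element of $G$ permutes its parts. -}

module Defs where

open import Data.Nat using (ℕ; zero; suc; _+_; _*_; _∸_; _≤_; _<_)
open import Data.Bool using (Bool; true; false; if_then_else_; _∧_)
open import Data.Fin using (Fin; zero; suc; _≟_)
open import Data.Fin.Subset using (Subset; ∣_∣)
open import Data.Fin.Permutation using (Permutation; _⟨$⟩ʳ_; _⟨$⟩ˡ_; id; flip; _∘ₚ_)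
open import Data.Vec using (lookup; tabulate)
open import Data.Product using (Σ; _×_; _,_)
open import Relation.Nullary using (does; ¬_)
open import Relation.Binary.PropositionalEquality using (_≡_; _≢_)
open import Function using (_∘_)

countWhere : ∀ {n} → (Fin n → Bool) → ℕ
countWhere {zero}  f = 0
countWhere {suc n} f = (if f zero then 1 else 0) + countWhere (f ∘ suc)

replication : ∀ {v b} → (Fin b → Subset v) → Fin v → ℕ
replication B p = countWhere (λ i → lookup (B i) p)

pairCount : ∀ {v b} → (Fin b → Subset v) → Fin v → Fin v → ℕ
pairCount B p q = countWhere (λ i → lookup (B i) p ∧ lookup (B i) q)

record IsNontrivial2Design (v k lam : ℕ) {b : ℕ} (B : Fin b → Subset v) : Set where
  field
    k>2        : 2 < k
    k<v        : k < v
    lam≥1      : 1 ≤ lam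
    distinct   : ∀ i j → B i ≡ B j → i ≡ j
    blockSize  : ∀ i → ∣ B i ∣ ≡ k
    balanced   : ∀ p q → p ≢ q → pairCount B p q ≡ lam

image : ∀ {v} → Permutation v v → Subset v → Subset v
image g S = tabulate (λ q → lookup S (g ⟨$⟩ˡ q))

record IsPermGroup {v : ℕ} (G : Permutation v v → Set) : Set where
  field
    hasId   : G id
    closed∘ : ∀ g h → G g → G h → G (g ∘ₚ h)
    closed⁻¹ : ∀ g → G g → G (flip g)

IsAutomorphism : ∀ {v b} → (Fin b → Subset v) → Permutation v v → Set
IsAutomorphism B g = ∀ i → Σ _ (λ j → image g (B i) ≡ B j)

FlagTransitive : ∀ {v b} → (Fin b → Subset v) → (Permutation v v → Set) → Set
FlagTransitive B G =
  ∀ p i q j → lookup (B i) p ≡ true → lookup (B j) q ≡ true →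
  Σ _ (λ g → G g × (g ⟨$⟩ʳ p ≡ q) × (image g (B i) ≡ B j))

IsPartitionInto : ∀ {v} (d c : ℕ) → (Fin v → Fin d) → Set
IsPartitionInto d c part = ∀ j → countWhere (λ p → does (part p ≟ j)) ≡ c

Invariant : ∀ {v d} → (Permutation v v → Set) → (Fin v → Fin d) → Set
Invariant G part =
  ∀ g → G g → ∀ p q → part p ≡ part q → part (g ⟨$⟩ʳ p) ≡ part (g ⟨$⟩ʳ q)

interSize : ∀ {v d} → (Fin v → Fin d) → Subset v → Fin d → ℕ
interSize part S j = countWhere (λ p → lookup S p ∧ does (part p ≟ j))

-- Fix a point p and a weight h on the points.  Counting the pairs (B, q) with
-- p, q ∈ B gives Σ_{B ∋ p} Σ_{q ∈ B} h q = (r − λ) h p + λ Σ h.  For h ≡ 1 this is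
-- r(k − 1) = λ(v − 1).  Flag-transitivity maps any flag to any other while
-- preserving the partition, so all nonempty B ∩ Δ have one size ℓ, and taking h
-- the indicator of the part of p gives r(ℓ − 1) = λ(c − 1).  Taking h the
-- indicator of a block B₀ gives the first two moments of the intersection numbers
-- |B ∩ B₀|, and Σ_{B ≠ B₀} (r |B ∩ B₀| − λk)² ≥ 0 is Fisher's inequality k ≤ r.
-- The rest is arithmetic: with x = k − 1 − d(ℓ − 1) the two counting identities
-- give r x = λ(d − 1) and k = xc + ℓ, and together with bk = vr, v = dc and k ≤ r
-- they yield the divisibilities and bounds.

module Submission where

open import Defs
open import Data.Nat using (ℕ; _+_; _*_; _∸_; _^_; _≤_; _<_)
open import Data.Nat.Divisibility using (_∣_)
open import Data.Fin using (Fin)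
open import Data.Fin.Subset using (Subset)
open import Data.Fin.Permutation using (Permutation)
open import Data.Product using (Σ; _×_)
open import Relation.Binary.PropositionalEquality using (_≡_; _≢_)

open import Data.Nat using (zero; suc; z≤n; s≤s; NonZero; >-nonZero)
open import Data.Nat.Properties hiding (_≟_)
open import Data.Nat.Divisibility using (_∣0; ∣-reflexive; ∣m∣n⇒∣m+n; ∣m+n∣m⇒∣n; n∣m*n; m∣m*n; n∣m*n*o; ∣n⇒∣m*n)
open import Data.Nat.Tactic.RingSolver using (solve-∀)
open import Data.Bool using (Bool; true; false; _∧_; T)
open import Data.Bool.Properties using (T-∧; T-≡)
open import Data.Fin using (zero; suc; _≟_; fromℕ<)
open import Data.Fin.Subset using (∣_∣)
open import Data.Fin.Permutation using (_⟨$⟩ʳ_; _⟨$⟩ˡ_; inverseˡ)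
open import Data.Vec using ([]; _∷_; lookup)
open import Data.Vec.Properties using (lookup∘tabulate)
open import Data.Vec.Functional using (removeAt)
open import Data.Product using (∃; _,_; proj₁; proj₂)
open import Data.Sum using (inj₁; inj₂)
open import Data.Empty using (⊥; ⊥-elim)
open import Function using (_∘_; Equivalence)
open import Relation.Nullary using (does; yes; no; contradiction)
open import Relation.Nullary.Decidable using (dec-true)
open import Relation.Binary.PropositionalEquality
  using (refl; sym; trans; cong; cong₂; subst; ≢-sym; module ≡-Reasoning)
open import Algebra.Properties.Semiring.Sum +-*-semiring
  using (sum; sum-cong-≗; ∑-comm; ∑-distrib-+; *-distribˡ-sum; *-distribʳ-sum;
         sum-permute; sum-remove; sum-replicate-zero)

𝟙 : Bool → ℕ
𝟙 true  = 1
𝟙 false = 0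

𝟙-∧ : ∀ a b → 𝟙 (a ∧ b) ≡ 𝟙 a * 𝟙 b
𝟙-∧ true  b = sym (+-identityʳ (𝟙 b))
𝟙-∧ false b = refl

𝟙-idem : ∀ a → 𝟙 a * 𝟙 a ≡ 𝟙 a
𝟙-idem true  = refl
𝟙-idem false = refl

𝟙-scale : ∀ a {x y z} → x + z * 𝟙 a ≡ y → 𝟙 a * x + z * 𝟙 a ≡ 𝟙 a * y
𝟙-scale true  {x} {y} {z} e =
  trans (cong (_+ z * 1) (*-identityˡ x)) (trans e (sym (*-identityˡ y)))
𝟙-scale false {z = z} _ = *-zeroʳ z

T-≟⇒≡ : ∀ {n} {i j : Fin n} → T (does (i ≟ j)) → i ≡ j
T-≟⇒≡ {i = i} {j} t with i ≟ j
... | yes i≡j = i≡j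

≡⇒T-≟ : ∀ {n} {i j : Fin n} → i ≡ j → T (does (i ≟ j))
≡⇒T-≟ {i = i} {j} i≡j = Equivalence.from T-≡ (dec-true (i ≟ j) i≡j)

δ : ∀ {n} → Fin n → Fin n → ℕ
δ i j = 𝟙 (does (i ≟ j))

δ-refl : ∀ {n} (i : Fin n) → δ i i ≡ 1
δ-refl i = cong 𝟙 (dec-true (i ≟ i) refl)

∑-δ : ∀ {n} (i : Fin n) (f : Fin n → ℕ) → sum (λ j → δ i j * f j) ≡ f i
∑-δ {suc n} zero f = trans (cong (_+ _) (*-identityˡ (f zero)))
  (trans (cong (f zero +_) (sum-replicate-zero n)) (+-identityʳ (f zero)))
∑-δ {suc n} (suc i) f = ∑-δ i (f ∘ suc)

∑-δ-count : ∀ {n} (i : Fin n) → sum (δ i) ≡ 1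
∑-δ-count i = trans (sum-cong-≗ (λ j → sym (*-identityʳ (δ i j)))) (∑-δ i (λ _ → 1))

∑-const : ∀ n c → sum {n} (λ _ → c) ≡ n * c
∑-const zero    c = refl
∑-const (suc n) c = cong (c +_) (∑-const n c)

∑-∣ : ∀ {n m} (f : Fin n → ℕ) → (∀ i → m ∣ f i) → m ∣ sum f
∑-∣ {zero}  f m∣f = _ ∣0
∑-∣ {suc n} f m∣f = ∣m∣n⇒∣m+n (m∣f zero) (∑-∣ (f ∘ suc) (m∣f ∘ suc))

∑∑-transpose : ∀ {m n} (A : Fin m → Fin n → ℕ) (g : Fin m → ℕ) (h : Fin n → ℕ) →
  sum (λ i → g i * sum (λ q → A i q * h q)) ≡ sum (λ q → h q * sum (λ i → A i q * g i))
∑∑-transpose A g h = begin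
  sum (λ i → g i * sum (λ q → A i q * h q))       ≡⟨ sum-cong-≗ (λ i → *-distribˡ-sum (g i) (λ q → A i q * h q)) ⟩
  sum (λ i → sum (λ q → g i * (A i q * h q)))     ≡⟨ ∑-comm (λ i q → g i * (A i q * h q)) ⟩
  sum (λ q → sum (λ i → g i * (A i q * h q)))     ≡⟨ sum-cong-≗ (λ q → sum-cong-≗ (λ i → swap (g i) (A i q) (h q))) ⟩
  sum (λ q → sum (λ i → h q * (A i q * g i)))     ≡⟨ sum-cong-≗ (λ q → *-distribˡ-sum (h q) (λ i → A i q * g i)) ⟨
  sum (λ q → h q * sum (λ i → A i q * g i))       ∎
  where
  open ≡-Reasoning
  swap : ∀ g a h → g * (a * h) ≡ h * (a * g)
  swap = solve-∀

countWhere≡∑ : ∀ {n} (f : Fin n → Bool) → countWhere f ≡ sum (𝟙 ∘ f)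
countWhere≡∑ {zero}  f = refl
countWhere≡∑ {suc n} f with f zero
... | true  = cong suc (countWhere≡∑ (f ∘ suc))
... | false = countWhere≡∑ (f ∘ suc)

∣S∣≡∑ : ∀ {n} (S : Subset n) → ∣ S ∣ ≡ sum (𝟙 ∘ lookup S)
∣S∣≡∑ []          = refl
∣S∣≡∑ (true  ∷ S) = cong suc (∣S∣≡∑ S)
∣S∣≡∑ (false ∷ S) = ∣S∣≡∑ S

countWhere-permute : ∀ {n} (f : Fin n → Bool) (π : Permutation n n) →
  countWhere (f ∘ (π ⟨$⟩ʳ_)) ≡ countWhere f
countWhere-permute f π = trans (countWhere≡∑ (f ∘ (π ⟨$⟩ʳ_)))
  (trans (sym (sum-permute (𝟙 ∘ f) π)) (sym (countWhere≡∑ f)))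

countWhere-mono : ∀ {n} {f g : Fin n → Bool} → (∀ q → T (f q) → T (g q)) →
  countWhere f ≤ countWhere g
countWhere-mono {zero}          f⇒g = z≤n
countWhere-mono {suc n} {f} {g} f⇒g with f zero | g zero | f⇒g zero
... | true  | true  | _   = s≤s (countWhere-mono (f⇒g ∘ suc))
... | true  | false | f⇒g₀ = ⊥-elim (f⇒g₀ _)
... | false | true  | _   = m≤n⇒m≤1+n (countWhere-mono (f⇒g ∘ suc))
... | false | false | _   = countWhere-mono (f⇒g ∘ suc)

countWhere≢0 : ∀ {n} (f : Fin n → Bool) q → T (f q) → countWhere f ≢ 0
countWhere≢0 {suc n} f zero fq with f zero
... | true  = λ ()
countWhere≢0 {suc n} f (suc q) fq with f zero
... | true  = λ ()
... | false = countWhere≢0 (f ∘ suc) q fq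

countWhere≢0⇒∃ : ∀ {n} (f : Fin n → Bool) → countWhere f ≢ 0 → ∃ λ q → T (f q)
countWhere≢0⇒∃ {zero}  f ≢0 = ⊥-elim (≢0 refl)
countWhere≢0⇒∃ {suc n} f ≢0 with f zero in f₀
... | true  = zero , subst T (sym f₀) _
... | false = let q , fq = countWhere≢0⇒∃ (f ∘ suc) ≢0 in suc q , fq

2ab≤a²+b²-ordered : ∀ {a b} → a ≤ b → 2 * a * b ≤ a * a + b * b
2ab≤a²+b²-ordered {a} a≤b with m≤n⇒∃[o]m+o≡n a≤b
... | t , refl = begin
  2 * a * (a + t)           ≤⟨ m≤m+n _ (t * t) ⟩
  2 * a * (a + t) + t * t   ≡⟨ square a t ⟩
  a * a + (a + t) * (a + t) ∎
  where
  open ≤-Reasoning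
  square : ∀ a t → 2 * a * (a + t) + t * t ≡ a * a + (a + t) * (a + t)
  square = solve-∀

2ab≤a²+b² : ∀ a b → 2 * a * b ≤ a * a + b * b
2ab≤a²+b² a b with ≤-total a b
... | inj₁ a≤b = 2ab≤a²+b²-ordered a≤b
... | inj₂ b≤a = begin
  2 * a * b      ≡⟨ flip a b ⟩
  2 * b * a      ≤⟨ 2ab≤a²+b²-ordered b≤a ⟩
  b * b + a * a  ≡⟨ +-comm (b * b) (a * a) ⟩
  a * a + b * b  ∎
  where
  open ≤-Reasoning
  flip : ∀ a b → 2 * a * b ≡ 2 * b * a
  flip = solve-∀

∑-AM-GM : ∀ {n} a c (f : Fin n → ℕ) →
  2 * a * c * sum f ≤ c * c * sum (λ i → f i * f i) + a * a * n
∑-AM-GM {zero}  a c f = subst (_≤ c * c * 0 + a * a * 0) (sym (*-zeroʳ (2 * a * c))) z≤n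
∑-AM-GM {suc n} a c f = begin
  2 * a * c * (f zero + sum (f ∘ suc))
    ≡⟨ *-distribˡ-+ (2 * a * c) (f zero) (sum (f ∘ suc)) ⟩
  2 * a * c * f zero + 2 * a * c * sum (f ∘ suc)
    ≤⟨ +-mono-≤ first (∑-AM-GM a c (f ∘ suc)) ⟩
  (a * a + c * f zero * (c * f zero)) + (c * c * S + a * a * n)
    ≡⟨ regroup a c (f zero) S n ⟩
  c * c * (f zero * f zero + S) + a * a * suc n ∎
  where
  open ≤-Reasoning
  S : ℕ
  S = sum (λ i → f (suc i) * f (suc i))
  reassoc : ∀ a c x → 2 * a * (c * x) ≡ 2 * a * c * x
  reassoc = solve-∀
  regroup : ∀ a c x S n →
    a * a + c * x * (c * x) + (c * c * S + a * a * n) ≡ c * c * (x * x + S) + a * a * (1 + n)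
  regroup = solve-∀
  first : 2 * a * c * f zero ≤ a * a + c * f zero * (c * f zero)
  first = subst (_≤ a * a + c * f zero * (c * f zero)) (reassoc a c (f zero)) (2ab≤a²+b² a (c * f zero))

cancel-pred : ∀ r lam m n → r * suc m + lam ≡ r + lam * suc n → r * m ≡ lam * n
cancel-pred r lam m n e = +-cancelʳ-≡ (r + lam) (r * m) (lam * n)
  (trans (split-r r m lam) (trans e (split-λ r lam n)))
  where
  split-r : ∀ r m lam → r * m + (r + lam) ≡ r * (1 + m) + lam
  split-r = solve-∀
  split-λ : ∀ r lam n → r + lam * (1 + n) ≡ lam * n + (r + lam)
  split-λ = solve-∀

λ<r-from-balance : ∀ {lam r k v} → 1 ≤ lam → 0 < k → k < v → r * k + lam ≡ r + lam * v → lam < r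
λ<r-from-balance {suc lam₀} {r} {suc K} {suc V} _ _ (s≤s K<V) e =
  *-cancelʳ-< K (suc lam₀) r (begin-strict
    suc lam₀ * K  <⟨ *-monoʳ-< (suc lam₀) K<V ⟩
    suc lam₀ * V  ≡⟨ cancel-pred r (suc lam₀) K V e ⟨
    r * K         ∎)
  where open ≤-Reasoning

1≤m*n⇒1≤m : ∀ {m n} → 1 ≤ m * n → 1 ≤ m
1≤m*n⇒1≤m {suc m} _ = s≤s z≤n

1≤m*n⇒1≤n : ∀ m {n} → 1 ≤ m * n → 1 ≤ n
1≤m*n⇒1≤n m {zero}  1≤m*0 = contradiction (subst (1 ≤_) (*-zeroʳ m) 1≤m*0) λ ()
1≤m*n⇒1≤n m {suc n} _     = s≤s z≤n

balance-pos : ∀ {r lam m n} → 1 ≤ lam → 1 < n → r * m + lam ≡ r + lam * n → 0 < m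
balance-pos {r} {suc lam₀} {zero} {n} _ 1<n e = ⊥-elim (<-irrefl refl (begin-strict
  suc lam₀             <⟨ m<m*n (suc lam₀) n 1<n ⟩
  suc lam₀ * n         ≤⟨ m≤n+m (suc lam₀ * n) r ⟩
  r + suc lam₀ * n     ≡⟨ e ⟨
  r * 0 + suc lam₀     ≡⟨ cong (_+ suc lam₀) (*-zeroʳ r) ⟩
  suc lam₀             ∎))
  where open ≤-Reasoning
balance-pos {m = suc m} _ _ _ = s≤s z≤n

-- Fisher's inequality

-- With T₁ = Σ Mᵢ and T₂ = Σ Mᵢ² over the blocks other than a fixed one, the moment
-- identities turn Σ (r Mᵢ − λk)² into k (r − k)(r − λ)², which is negative when
-- λ < r < k; `excess` is that identity with r = λ + 1 + u and k = r + 1 + s.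
fisher-contradiction : ∀ lam₀ u s {n v T₁ T₂} →
  let lam = suc lam₀ ; r = suc lam + u ; k = suc r + s in
  suc n * k ≡ v * r → r * k + lam ≡ r + lam * v →
  T₁ + k ≡ r * k → T₂ + k * k + lam * k ≡ r * k + lam * k * k →
  2 * (lam * k) * r * T₁ ≤ r * r * T₂ + lam * k * (lam * k) * n → ⊥
fisher-contradiction lam₀ u s {n} {v} {T₁} {T₂} bk≡vr r[k-1]≡λ[v-1] ∑T₁ ∑T₂ amgm =
  m+1+n≰m P (begin
    P + k * suc s * (suc u * suc u)                                    ≡⟨ excess lam₀ u s ⟩
    2 * (lam * k) * r * (k * (lam + u)) + lam * k * (lam * k + r * r)  ≡⟨ cong (λ t → 2 * (lam * k) * r * t + lam * k * (lam * k + r * r)) T₁≡ ⟨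
    2 * (lam * k) * r * T₁ + lam * k * (lam * k + r * r)               ≤⟨ +-monoˡ-≤ _ amgm ⟩
    r * r * T₂ + lam * k * (lam * k) * n + lam * k * (lam * k + r * r) ≡⟨ regroup (r * r * T₂) (lam * k) n (r * r) ⟩
    r * r * T₂ + lam * k * (lam * k * n + lam * k + r * r)             ≡⟨ cong₂ (λ t w → r * r * t + lam * k * w) T₂≡ W≡ ⟩
    P                                                                  ∎)
  where
  open ≤-Reasoning
  lam r k : ℕ
  lam = suc lam₀
  r = suc lam + u
  k = suc r + s
  P : ℕ
  P = r * r * (k * (lam + u) + k * (r + s) * lam₀) + lam * k * (r * r * k + r * lam)

  excess : ∀ lam₀ u s → let lam = suc lam₀ ; r = suc lam + u ; k = suc r + s in
    r * r * (k * (lam + u) + k * (r + s) * lam₀) + lam * k * (r * r * k + r * lam)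
      + k * suc s * (suc u * suc u)
    ≡ 2 * (lam * k) * r * (k * (lam + u)) + lam * k * (lam * k + r * r)
  excess = solve-∀
  regroup : ∀ A a n B → A + a * a * n + a * (a + B) ≡ A + a * (a * n + a + B)
  regroup = solve-∀

  T₁≡ : T₁ ≡ k * (lam + u)
  T₁≡ = +-cancelʳ-≡ k T₁ (k * (lam + u)) (trans ∑T₁ (rk lam₀ u s))
    where
    rk : ∀ lam₀ u s → let lam = suc lam₀ ; r = suc lam + u ; k = suc r + s in
      r * k ≡ k * (lam + u) + k
    rk = solve-∀

  T₂≡ : T₂ ≡ k * (lam + u) + k * (r + s) * lam₀
  T₂≡ = +-cancelʳ-≡ (k * k + lam * k) T₂ _
    (trans (sym (+-assoc T₂ (k * k) (lam * k))) (trans ∑T₂ (moment lam₀ u s)))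
    where
    moment : ∀ lam₀ u s → let lam = suc lam₀ ; r = suc lam + u ; k = suc r + s in
      r * k + lam * k * k ≡ k * (lam + u) + k * (r + s) * lam₀ + (k * k + lam * k)
    moment = solve-∀

  W≡ : lam * k * n + lam * k + r * r ≡ r * r * k + r * lam
  W≡ = begin-equality
    lam * k * n + lam * k + r * r  ≡⟨ expand lam k n r ⟩
    lam * (suc n * k) + r * r      ≡⟨ cong (λ t → lam * t + r * r) bk≡vr ⟩
    lam * (v * r) + r * r          ≡⟨ collect lam v r ⟩
    r * (r + lam * v)              ≡⟨ cong (r *_) r[k-1]≡λ[v-1] ⟨
    r * (r * k + lam)              ≡⟨ expand′ r k lam ⟩
    r * r * k + r * lam            ∎
    where
    expand : ∀ lam k n r → lam * k * n + lam * k + r * r ≡ lam * ((1 + n) * k) + r * r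
    expand = solve-∀
    collect : ∀ lam v r → lam * (v * r) + r * r ≡ r * (r + lam * v)
    collect = solve-∀
    expand′ : ∀ r k lam → r * (r * k + lam) ≡ r * r * k + r * lam
    expand′ = solve-∀

fisher-from-moments : ∀ {b k r lam v} (M : Fin b → ℕ) (i : Fin b) → 1 ≤ lam → lam < r →
  b * k ≡ v * r → r * k + lam ≡ r + lam * v →
  M i ≡ k → sum M ≡ r * k → sum (λ j → M j * M j) + lam * k ≡ r * k + lam * k * k → k ≤ r
fisher-from-moments {suc n} {k} {r} {suc lam₀} M i _ λ<r bk≡vr r[k-1]≡λ[v-1] Mᵢ≡k ∑M ∑M²
  with k ≤? r
... | yes k≤r = k≤r
... | no k≰r with m≤n⇒∃[o]m+o≡n λ<r | m≤n⇒∃[o]m+o≡n (≰⇒> k≰r)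
...   | u , refl | s , refl =
  ⊥-elim (fisher-contradiction lam₀ u s {n} bk≡vr r[k-1]≡λ[v-1] ∑T₁ ∑T₂ (∑-AM-GM (suc lam₀ * k) r (removeAt M i)))
  where
  removed : ∀ (f : Fin (suc n) → ℕ) → sum (removeAt f i) + f i ≡ sum f
  removed f = trans (+-comm (sum (removeAt f i)) (f i)) (sym (sum-remove f))
  ∑T₁ : sum (removeAt M i) + k ≡ r * k
  ∑T₁ = subst (λ m → sum (removeAt M i) + m ≡ r * k) Mᵢ≡k (trans (removed M) ∑M)
  ∑T₂ : sum (λ j → removeAt M i j * removeAt M i j) + k * k + suc lam₀ * k ≡ r * k + suc lam₀ * k * k
  ∑T₂ = subst (λ m → sum (λ j → removeAt M i j * removeAt M i j) + m * m + suc lam₀ * k ≡ r * k + suc lam₀ * k * k)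
          Mᵢ≡k (trans (cong (_+ suc lam₀ * k) (removed (λ j → M j * M j))) ∑M²)

-- Flag-transitivity

lookup-image : ∀ {v} (g : Permutation v v) (S : Subset v) p →
  lookup (image g S) (g ⟨$⟩ʳ p) ≡ lookup S p
lookup-image g S p =
  trans (lookup∘tabulate (λ q → lookup S (g ⟨$⟩ˡ q)) (g ⟨$⟩ʳ p)) (cong (lookup S) (inverseˡ g))

module _ {v b d} {B : Fin b → Subset v} {G : Permutation v v → Set} {part : Fin v → Fin d}
         (FT : FlagTransitive B G) (Inv : Invariant G part) where

  interSize-flag-≤ : ∀ {i p i′ p′} → lookup (B i) p ≡ true → lookup (B i′) p′ ≡ true →
    interSize part (B i) (part p) ≤ interSize part (B i′) (part p′)
  interSize-flag-≤ {i} {p} {i′} {p′} p∈Bᵢ p′∈Bᵢ′ with FT p i p′ i′ p∈Bᵢ p′∈Bᵢ′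
  ... | g , g∈G , gp≡p′ , gBᵢ≡Bᵢ′ = begin
    countWhere F                 ≤⟨ countWhere-mono moved ⟩
    countWhere (F′ ∘ (g ⟨$⟩ʳ_))  ≡⟨ countWhere-permute F′ g ⟩
    countWhere F′                ∎
    where
    open ≤-Reasoning
    F F′ : Fin v → Bool
    F  q = lookup (B i) q ∧ does (part q ≟ part p)
    F′ q = lookup (B i′) q ∧ does (part q ≟ part p′)
    moved : ∀ q → T (F q) → T (F′ (g ⟨$⟩ʳ q))
    moved q Fq with Equivalence.to T-∧ Fq
    ... | q∈Bᵢ , q∈Δ = Equivalence.from T-∧
      ( subst T (trans (sym (lookup-image g (B i) q)) (cong (λ S → lookup S (g ⟨$⟩ʳ q)) gBᵢ≡Bᵢ′)) q∈Bᵢ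
      , ≡⇒T-≟ (trans (Inv g g∈G q p (T-≟⇒≡ q∈Δ)) (cong part gp≡p′)))

  interSize-constant : ∀ {i₀ p₀} → lookup (B i₀) p₀ ≡ true →
    ∀ i j → interSize part (B i) j ≢ 0 → interSize part (B i) j ≡ interSize part (B i₀) (part p₀)
  interSize-constant p₀∈Bᵢ₀ i j ≢0
    with countWhere≢0⇒∃ (λ q → lookup (B i) q ∧ does (part q ≟ j)) ≢0
  ... | q , Fq with Equivalence.to T-∧ Fq
  ... | q∈Bᵢ , q∈Δⱼ with T-≟⇒≡ {i = part q} {j} q∈Δⱼ
  ... | refl = ≤-antisym (interSize-flag-≤ q∈Bᵢ′ p₀∈Bᵢ₀) (interSize-flag-≤ p₀∈Bᵢ₀ q∈Bᵢ′)
    where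
    q∈Bᵢ′ : lookup (B i) q ≡ true
    q∈Bᵢ′ = Equivalence.to T-≡ q∈Bᵢ

-- Partitions and designs

module Partition {v d c} {part : Fin v → Fin d} (P : IsPartitionInto d c part) where

  cell : Fin d → Fin v → ℕ
  cell j q = δ (part q) j

  ∑cell : ∀ j → sum (cell j) ≡ c
  ∑cell j = trans (sym (countWhere≡∑ (λ q → does (part q ≟ j)))) (P j)

  interSize≡∑ : ∀ S j → interSize part S j ≡ sum (λ q → 𝟙 (lookup S q) * cell j q)
  interSize≡∑ S j = trans (countWhere≡∑ (λ q → lookup S q ∧ does (part q ≟ j)))
    (sum-cong-≗ (λ q → 𝟙-∧ (lookup S q) (does (part q ≟ j))))

  ∑-interSize : ∀ S → sum (interSize part S) ≡ ∣ S ∣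
  ∑-interSize S = begin
    sum (interSize part S)                                    ≡⟨ sum-cong-≗ (interSize≡∑ S) ⟩
    sum (λ j → sum (λ q → 𝟙 (lookup S q) * cell j q))          ≡⟨ ∑-comm (λ j q → 𝟙 (lookup S q) * cell j q) ⟩
    sum (λ q → sum (λ j → 𝟙 (lookup S q) * δ (part q) j))     ≡⟨ sum-cong-≗ (λ q → *-distribˡ-sum (𝟙 (lookup S q)) (δ (part q))) ⟨
    sum (λ q → 𝟙 (lookup S q) * sum (δ (part q)))             ≡⟨ sum-cong-≗ (λ q → cong (𝟙 (lookup S q) *_) (∑-δ-count (part q))) ⟩
    sum (λ q → 𝟙 (lookup S q) * 1)                            ≡⟨ sum-cong-≗ (λ q → *-identityʳ (𝟙 (lookup S q))) ⟩
    sum (𝟙 ∘ lookup S)                                        ≡⟨ ∣S∣≡∑ S ⟨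
    ∣ S ∣                                                     ∎
    where open ≡-Reasoning

  v≡dc : v ≡ d * c
  v≡dc = begin
    v                                  ≡⟨ *-identityʳ v ⟨
    v * 1                              ≡⟨ ∑-const v 1 ⟨
    sum {v} (λ q → 1)                  ≡⟨ sum-cong-≗ (λ q → ∑-δ-count (part q)) ⟨
    sum (λ q → sum (λ j → cell j q))   ≡⟨ ∑-comm (λ q j → cell j q) ⟩
    sum (λ j → sum (cell j))           ≡⟨ sum-cong-≗ ∑cell ⟩
    sum {d} (λ j → c)                  ≡⟨ ∑-const d c ⟩
    d * c                              ∎
    where open ≡-Reasoning

module Design {v k lam r b : ℕ} {B : Fin b → Subset v}
              (D : IsNontrivial2Design v k lam B) (R : ∀ p → replication B p ≡ r) where

  open IsNontrivial2Design D

  χ : Fin b → Fin v → ℕ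
  χ i p = 𝟙 (lookup (B i) p)

  ∑χ-block : ∀ i → sum (χ i) ≡ k
  ∑χ-block i = trans (sym (∣S∣≡∑ (B i))) (blockSize i)

  ∑χ-point : ∀ p → sum (λ i → χ i p) ≡ r
  ∑χ-point p = trans (sym (countWhere≡∑ (λ i → lookup (B i) p))) (R p)

  pairs : Fin v → Fin v → ℕ
  pairs q p = sum (λ i → χ i q * χ i p)

  pairs-diag : ∀ p → pairs p p ≡ r
  pairs-diag p = trans (sum-cong-≗ (λ i → 𝟙-idem (lookup (B i) p))) (∑χ-point p)

  pairs-offdiag : ∀ {q p} → q ≢ p → pairs q p ≡ lam
  pairs-offdiag {q} {p} q≢p =
    trans (sum-cong-≗ (λ i → sym (𝟙-∧ (lookup (B i) q) (lookup (B i) p))))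
          (trans (sym (countWhere≡∑ (λ i → lookup (B i) q ∧ lookup (B i) p))) (balanced q p q≢p))

  ∑-pairs : ∀ p (h : Fin v → ℕ) → sum (λ q → h q * pairs q p) + lam * h p ≡ r * h p + lam * sum h
  ∑-pairs p h = begin
    sum (λ q → h q * pairs q p) + lam * h p
      ≡⟨ cong (λ t → sum (λ q → h q * pairs q p) + lam * t) (∑-δ p h) ⟨
    sum (λ q → h q * pairs q p) + lam * sum (λ q → δ p q * h q)
      ≡⟨ cong (sum (λ q → h q * pairs q p) +_) (*-distribˡ-sum lam (λ q → δ p q * h q)) ⟩
    sum (λ q → h q * pairs q p) + sum (λ q → lam * (δ p q * h q))
      ≡⟨ ∑-distrib-+ (λ q → h q * pairs q p) (λ q → lam * (δ p q * h q)) ⟨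
    sum (λ q → h q * pairs q p + lam * (δ p q * h q))
      ≡⟨ sum-cong-≗ pointwise ⟩
    sum (λ q → r * (δ p q * h q) + lam * h q)
      ≡⟨ ∑-distrib-+ (λ q → r * (δ p q * h q)) (λ q → lam * h q) ⟩
    sum (λ q → r * (δ p q * h q)) + sum (λ q → lam * h q)
      ≡⟨ cong₂ _+_ (trans (sym (*-distribˡ-sum r (λ q → δ p q * h q))) (cong (r *_) (∑-δ p h)))
                   (sym (*-distribˡ-sum lam h)) ⟩
    r * h p + lam * sum h
      ∎
    where
    open ≡-Reasoning
    diagonal : ∀ h r lam → h * r + lam * (1 * h) ≡ r * (1 * h) + lam * h
    diagonal = solve-∀
    off-diagonal : ∀ h r lam → h * lam + lam * 0 ≡ r * 0 + lam * h
    off-diagonal = solve-∀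
    pointwise : ∀ q → h q * pairs q p + lam * (δ p q * h q) ≡ r * (δ p q * h q) + lam * h q
    pointwise q with p ≟ q
    ... | yes refl = trans (cong (λ t → h p * t + lam * (1 * h p)) (pairs-diag p)) (diagonal (h p) r lam)
    ... | no p≢q   = trans (cong (λ t → h q * t + lam * 0) (pairs-offdiag (≢-sym p≢q))) (off-diagonal (h q) r lam)

  ∑-blocksThrough : ∀ p (h : Fin v → ℕ) →
    sum (λ i → χ i p * sum (λ q → χ i q * h q)) + lam * h p ≡ r * h p + lam * sum h
  ∑-blocksThrough p h = trans (cong (_+ lam * h p) (∑∑-transpose χ (λ i → χ i p) h)) (∑-pairs p h)

  p₀ : Fin v
  p₀ = fromℕ< (≤-trans (s≤s z≤n) k<v)

  bk≡vr : b * k ≡ v * r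
  bk≡vr = begin
    b * k                          ≡⟨ ∑-const b k ⟨
    sum {b} (λ i → k)              ≡⟨ sum-cong-≗ ∑χ-block ⟨
    sum (λ i → sum (χ i))          ≡⟨ ∑-comm χ ⟩
    sum (λ p → sum (λ i → χ i p))  ≡⟨ sum-cong-≗ ∑χ-point ⟩
    sum {v} (λ p → r)              ≡⟨ ∑-const v r ⟩
    v * r                          ∎
    where open ≡-Reasoning

  -- Named after the paper's r(k − 1) = λ(v − 1), but stated without truncated subtraction.
  r[k-1]≡λ[v-1] : r * k + lam ≡ r + lam * v
  r[k-1]≡λ[v-1] = begin
    r * k + lam
      ≡⟨ cong₂ _+_ ∑χk (*-identityʳ lam) ⟨
    sum (λ i → χ i p₀ * sum (λ q → χ i q * 1)) + lam * 1
      ≡⟨ ∑-blocksThrough p₀ (λ _ → 1) ⟩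
    r * 1 + lam * sum {v} (λ _ → 1)
      ≡⟨ cong₂ (λ a t → a + lam * t) (*-identityʳ r) (trans (∑-const v 1) (*-identityʳ v)) ⟩
    r + lam * v
      ∎
    where
    open ≡-Reasoning
    ∑χk : sum (λ i → χ i p₀ * sum (λ q → χ i q * 1)) ≡ r * k
    ∑χk = begin
      sum (λ i → χ i p₀ * sum (λ q → χ i q * 1))
        ≡⟨ sum-cong-≗ (λ i → cong (χ i p₀ *_) (trans (sum-cong-≗ (λ q → *-identityʳ (χ i q))) (∑χ-block i))) ⟩
      sum (λ i → χ i p₀ * k)   ≡⟨ *-distribʳ-sum k (λ i → χ i p₀) ⟨
      sum (λ i → χ i p₀) * k   ≡⟨ cong (_* k) (∑χ-point p₀) ⟩
      r * k                    ∎

  λ<r : lam < r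
  λ<r = λ<r-from-balance lam≥1 (≤-trans (s≤s z≤n) k>2) k<v r[k-1]≡λ[v-1]

  blockThrough : ∀ p → Σ (Fin b) λ i → lookup (B i) p ≡ true
  blockThrough p with countWhere≢0⇒∃ (λ i → lookup (B i) p) r≢0
    where
    r≢0 : replication B p ≢ 0
    r≢0 rep≡0 = n≮0 (subst (lam <_) (trans (sym (R p)) rep≡0) λ<r)
  ... | i , p∈Bᵢ = i , Equivalence.to T-≡ p∈Bᵢ

  i₀ : Fin b
  i₀ = proj₁ (blockThrough p₀)

  p₀∈Bᵢ₀ : lookup (B i₀) p₀ ≡ true
  p₀∈Bᵢ₀ = proj₂ (blockThrough p₀)

  k≤r : k ≤ r
  k≤r = fisher-from-moments M i₀ lam≥1 λ<r bk≡vr r[k-1]≡λ[v-1] Mᵢ₀≡k ∑M ∑M²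
    where
    open ≡-Reasoning
    M : Fin b → ℕ
    M i = sum (λ q → χ i q * χ i₀ q)
    Mᵢ₀≡k : M i₀ ≡ k
    Mᵢ₀≡k = trans (sum-cong-≗ (λ q → 𝟙-idem (lookup (B i₀) q))) (∑χ-block i₀)
    ∑M : sum M ≡ r * k
    ∑M = begin
      sum M                                    ≡⟨ ∑-comm (λ i q → χ i q * χ i₀ q) ⟩
      sum (λ q → sum (λ i → χ i q * χ i₀ q))   ≡⟨ sum-cong-≗ (λ q → *-distribʳ-sum (χ i₀ q) (λ i → χ i q)) ⟨
      sum (λ q → sum (λ i → χ i q) * χ i₀ q)   ≡⟨ sum-cong-≗ (λ q → cong (_* χ i₀ q) (∑χ-point q)) ⟩
      sum (λ q → r * χ i₀ q)                   ≡⟨ *-distribˡ-sum r (χ i₀) ⟨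
      r * sum (χ i₀)                           ≡⟨ cong (r *_) (∑χ-block i₀) ⟩
      r * k                                    ∎
    S : Fin v → ℕ
    S q = sum (λ i → χ i q * M i)
    weighted : ∀ q → χ i₀ q * S q + lam * χ i₀ q ≡ χ i₀ q * (lam * k) + r * χ i₀ q
    weighted q = trans (𝟙-scale (lookup (B i₀) q) {z = lam}
                   (trans (∑-blocksThrough q (χ i₀)) (cong (λ t → r * χ i₀ q + lam * t) (∑χ-block i₀))))
                 (sym (𝟙-scale (lookup (B i₀) q) {z = r} (+-comm (lam * k) (r * χ i₀ q))))
    ∑M² : sum (λ i → M i * M i) + lam * k ≡ r * k + lam * k * k
    ∑M² = begin
      sum (λ i → M i * M i) + lam * k
        ≡⟨ cong₂ _+_ (∑∑-transpose χ M (χ i₀)) (cong (lam *_) (sym (∑χ-block i₀))) ⟩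
      sum (λ q → χ i₀ q * S q) + lam * sum (χ i₀)
        ≡⟨ cong (sum (λ q → χ i₀ q * S q) +_) (*-distribˡ-sum lam (χ i₀)) ⟩
      sum (λ q → χ i₀ q * S q) + sum (λ q → lam * χ i₀ q)
        ≡⟨ ∑-distrib-+ (λ q → χ i₀ q * S q) (λ q → lam * χ i₀ q) ⟨
      sum (λ q → χ i₀ q * S q + lam * χ i₀ q)
        ≡⟨ sum-cong-≗ weighted ⟩
      sum (λ q → χ i₀ q * (lam * k) + r * χ i₀ q)
        ≡⟨ ∑-distrib-+ (λ q → χ i₀ q * (lam * k)) (λ q → r * χ i₀ q) ⟩
      sum (λ q → χ i₀ q * (lam * k)) + sum (λ q → r * χ i₀ q)
        ≡⟨ cong₂ _+_ (*-distribʳ-sum (lam * k) (χ i₀)) (*-distribˡ-sum r (χ i₀)) ⟨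
      sum (χ i₀) * (lam * k) + r * sum (χ i₀)
        ≡⟨ cong (λ t → t * (lam * k) + r * t) (∑χ-block i₀) ⟩
      k * (lam * k) + r * k
        ≡⟨ rearrange k lam r ⟩
      r * k + lam * k * k
        ∎
      where
      rearrange : ∀ k lam r → k * (lam * k) + r * k ≡ r * k + lam * k * k
      rearrange = solve-∀

  module _ {c d} {part : Fin v → Fin d} (P : IsPartitionInto d c part) {ℓ : ℕ}
           (constant : ∀ i j → interSize part (B i) j ≢ 0 → interSize part (B i) j ≡ ℓ) where

    open Partition {part = part} P

    ℓ∣interSize : ∀ i j → ℓ ∣ interSize part (B i) j
    ℓ∣interSize i j with interSize part (B i) j in size
    ... | zero  = ℓ ∣0
    ... | suc _ = ∣-reflexive (trans (sym (constant i j (λ empty → 0≢1+n (trans (sym empty) size)))) size)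

    ℓ∣k : ℓ ∣ k
    ℓ∣k = subst (ℓ ∣_) (trans (∑-interSize (B i₀)) (blockSize i₀)) (∑-∣ (interSize part (B i₀)) (ℓ∣interSize i₀))

    χ*interSize : ∀ i p → χ i p * interSize part (B i) (part p) ≡ χ i p * ℓ
    χ*interSize i p with lookup (B i) p in p∈Bᵢ
    ... | false = refl
    ... | true  = cong (1 *_) (constant i (part p) (countWhere≢0 _ p p∈Bᵢ∩Δ))
      where
      p∈Bᵢ∩Δ : T (lookup (B i) p ∧ does (part p ≟ part p))
      p∈Bᵢ∩Δ = Equivalence.from T-∧ (subst T (sym p∈Bᵢ) _ , ≡⇒T-≟ {i = part p} refl)

    r[ℓ-1]≡λ[c-1] : r * ℓ + lam ≡ r + lam * c
    r[ℓ-1]≡λ[c-1] = begin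
      r * ℓ + lam
        ≡⟨ cong₂ _+_ ∑χℓ (trans (cong (lam *_) (δ-refl (part p₀))) (*-identityʳ lam)) ⟨
      sum (λ i → χ i p₀ * sum (λ q → χ i q * cell (part p₀) q)) + lam * cell (part p₀) p₀
        ≡⟨ ∑-blocksThrough p₀ (cell (part p₀)) ⟩
      r * cell (part p₀) p₀ + lam * sum (cell (part p₀))
        ≡⟨ cong₂ (λ a t → r * a + lam * t) (δ-refl (part p₀)) (∑cell (part p₀)) ⟩
      r * 1 + lam * c
        ≡⟨ cong (_+ lam * c) (*-identityʳ r) ⟩
      r + lam * c
        ∎
      where
      open ≡-Reasoning
      ∑χℓ : sum (λ i → χ i p₀ * sum (λ q → χ i q * cell (part p₀) q)) ≡ r * ℓ
      ∑χℓ = begin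
        sum (λ i → χ i p₀ * sum (λ q → χ i q * cell (part p₀) q))
          ≡⟨ sum-cong-≗ (λ i → cong (χ i p₀ *_) (interSize≡∑ (B i) (part p₀))) ⟨
        sum (λ i → χ i p₀ * interSize part (B i) (part p₀))  ≡⟨ sum-cong-≗ (λ i → χ*interSize i p₀) ⟩
        sum (λ i → χ i p₀ * ℓ)                               ≡⟨ *-distribʳ-sum ℓ (λ i → χ i p₀) ⟨
        sum (λ i → χ i p₀) * ℓ                               ≡⟨ cong (_* ℓ) (∑χ-point p₀) ⟩
        r * ℓ                                                ∎

-- The imprimitivity parameters

module Imprimitivity {lam r b C D L x : ℕ} {{_ : NonZero lam}}
  (rL≡λC : r * L ≡ lam * C) (rx≡λD : r * x ≡ lam * D) (dL≡xC+L : suc D * L ≡ x * C + L) where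

  c d ℓ k : ℕ
  c = suc C
  d = suc D
  ℓ = suc L
  k = x * c + ℓ

  k≡x+1+dL : k ≡ (x + 1) + d * L
  k≡x+1+dL = trans (regroup x C L) (cong ((x + 1) +_) (sym dL≡xC+L))
    where
    regroup : ∀ x C L → x * (1 + C) + (1 + L) ≡ (x + 1) + (x * C + L)
    regroup = solve-∀

  x+d[ℓ-1]+1≡k : x + d * (ℓ ∸ 1) + 1 ≡ k
  x+d[ℓ-1]+1≡k = trans (regroup x (d * L)) (sym k≡x+1+dL)
    where
    regroup : ∀ x y → x + y + 1 ≡ (x + 1) + y
    regroup = solve-∀

  k∸[x+1]≡dL : k ∸ (x + 1) ≡ d * L
  k∸[x+1]≡dL = trans (cong (_∸ (x + 1)) k≡x+1+dL) (m+n∸m≡n (x + 1) (d * L))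

  ℓ<k : 1 ≤ x → ℓ < k
  ℓ<k 1≤x = m<n+m ℓ (*-mono-≤ 1≤x (s≤s z≤n))

  rk≡λCD+λD+λC+r : r * k ≡ lam * C * D + (lam * D + lam * C + r)
  rk≡λCD+λD+λC+r = begin
    r * k                               ≡⟨ expand r x C L ⟩
    r * x * c + r * L + r               ≡⟨ cong₂ (λ a t → a * c + t + r) rx≡λD rL≡λC ⟩
    lam * D * c + lam * C + r           ≡⟨ regroup lam C D r ⟩
    lam * C * D + (lam * D + lam * C + r) ∎
    where
    open ≡-Reasoning
    expand : ∀ r x C L → r * (x * (1 + C) + (1 + L)) ≡ r * x * (1 + C) + r * L + r
    expand = solve-∀
    regroup : ∀ lam C D r → lam * D * (1 + C) + lam * C + r ≡ lam * C * D + (lam * D + lam * C + r)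
    regroup = solve-∀

  module _ (bk≡vr : b * k ≡ d * c * r) where

    λcC·dL≡bkL² : lam * c * C * (d * L) ≡ b * k * L ^ 2
    λcC·dL≡bkL² = begin
      lam * c * C * (d * L)  ≡⟨ regroup lam C D L ⟩
      d * c * (lam * C) * L  ≡⟨ cong (λ t → d * c * t * L) rL≡λC ⟨
      d * c * (r * L) * L    ≡⟨ regroup′ D C r L ⟩
      d * c * r * L ^ 2      ≡⟨ cong (_* L ^ 2) bk≡vr ⟨
      b * k * L ^ 2          ∎
      where
      open ≡-Reasoning
      regroup : ∀ lam C D L → lam * (1 + C) * C * ((1 + D) * L) ≡ (1 + D) * (1 + C) * (lam * C) * L
      regroup = solve-∀
      regroup′ : ∀ D C r L → (1 + D) * (1 + C) * (r * L) * L ≡ (1 + D) * (1 + C) * r * (L * (L * 1))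
      regroup′ = solve-∀

    λc[c-1][k-x-1]≡bk[ℓ-1]² : lam * c * (c ∸ 1) * (k ∸ (x + 1)) ≡ b * k * (ℓ ∸ 1) ^ 2
    λc[c-1][k-x-1]≡bk[ℓ-1]² = trans (cong (lam * c * C *_) k∸[x+1]≡dL) λcC·dL≡bkL²

    k∣λc[c-1][x+1] : k ∣ lam * c * (c ∸ 1) * (x + 1)
    k∣λc[c-1][x+1] = ∣m+n∣m⇒∣n (subst (k ∣_) split (n∣m*n (lam * c * C))) (n∣m*n*o b (L ^ 2))
      where
      split : lam * c * C * k ≡ b * k * L ^ 2 + lam * c * C * (x + 1)
      split = begin
        lam * c * C * k                                    ≡⟨ cong (lam * c * C *_) k≡x+1+dL ⟩
        lam * c * C * ((x + 1) + d * L)                    ≡⟨ *-distribˡ-+ (lam * c * C) (x + 1) (d * L) ⟩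
        lam * c * C * (x + 1) + lam * c * C * (d * L)      ≡⟨ +-comm (lam * c * C * (x + 1)) _ ⟩
        lam * c * C * (d * L) + lam * c * C * (x + 1)      ≡⟨ cong (_+ lam * c * C * (x + 1)) λcC·dL≡bkL² ⟩
        b * k * L ^ 2 + lam * c * C * (x + 1)              ∎
        where open ≡-Reasoning

    -- Modulo k = xc + ℓ one has ℓ(x + ℓ) ≡ x²c(c − 1), which reduces the claim to the previous one.
    k∣λℓ[x+1][x+ℓ] : k ∣ lam * ℓ * (x + 1) * (x + ℓ)
    k∣λℓ[x+1][x+ℓ] = ∣m+n∣m⇒∣n
      (subst (k ∣_) (sym (certificate lam x C L))
        (∣m∣n⇒∣m+n (m∣m*n (lam * (x + 1) * ℓ)) (∣n⇒∣m*n (x * x) k∣λc[c-1][x+1])))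
      (m∣m*n (lam * (x + 1) * (x * C)))
      where
      certificate : ∀ lam x C L → let c = 1 + C ; ℓ = 1 + L ; k = x * c + ℓ in
        k * (lam * (x + 1) * (x * C)) + lam * ℓ * (x + 1) * (x + ℓ)
          ≡ k * (lam * (x + 1) * ℓ) + x * x * (lam * c * C * (x + 1))
      certificate = solve-∀

  module _ (k≤r : k ≤ r) where

    x[ℓ-1]<λ : x * (ℓ ∸ 1) < lam
    x[ℓ-1]<λ = *-cancelʳ-< (r * r) (x * L) lam (begin-strict
      x * L * (r * r)         ≡⟨ regroup x L r ⟩
      r * x * (r * L)         ≡⟨ cong₂ _*_ rx≡λD rL≡λC ⟩
      lam * D * (lam * C)     ≡⟨ regroup′ lam D C ⟩
      lam * (lam * C * D)     <⟨ *-monoʳ-< lam λCD<rk ⟩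
      lam * (r * k)           ≤⟨ *-monoʳ-≤ lam (*-monoʳ-≤ r k≤r) ⟩
      lam * (r * r)           ∎)
      where
      open ≤-Reasoning
      regroup : ∀ x L r → x * L * (r * r) ≡ r * x * (r * L)
      regroup = solve-∀
      regroup′ : ∀ lam D C → lam * D * (lam * C) ≡ lam * (lam * C * D)
      regroup′ = solve-∀
      0<r : 0 < r
      0<r = ≤-trans (s≤s z≤n) (≤-trans (m≤n+m ℓ (x * c)) k≤r)
      λCD<rk : lam * C * D < r * k
      λCD<rk = subst (lam * C * D <_) (sym rk≡λCD+λD+λC+r)
        (m<m+n (lam * C * D) (≤-trans 0<r (m≤n+m r (lam * D + lam * C))))

    λ+ℓ[ℓ-1]≤c[λ-x[ℓ-1]] : lam + ℓ * (ℓ ∸ 1) ≤ c * (lam ∸ x * (ℓ ∸ 1))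
    λ+ℓ[ℓ-1]≤c[λ-x[ℓ-1]] = subst (lam + ℓ * L ≤_) (sym (*-distribˡ-∸ c lam (x * L)))
      (m+n≤o⇒m≤o∸n (lam + ℓ * L) (begin
        lam + ℓ * L + c * (x * L)  ≡⟨ regroup lam x C L ⟩
        lam + k * L                ≤⟨ +-monoʳ-≤ lam (*-monoˡ-≤ L k≤r) ⟩
        lam + r * L                ≡⟨ cong (lam +_) rL≡λC ⟩
        lam + lam * C              ≡⟨ regroup′ lam C ⟩
        c * lam                    ∎))
      where
      open ≤-Reasoning
      regroup : ∀ lam x C L → lam + (1 + L) * L + (1 + C) * (x * L) ≡ lam + (x * (1 + C) + (1 + L)) * L
      regroup = solve-∀
      regroup′ : ∀ lam C → lam + lam * C ≡ (1 + C) * lam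
      regroup′ = solve-∀

    λ[x+ℓ]≤k[λ-x[ℓ-1]] : lam * (x + ℓ) ≤ k * (lam ∸ x * (ℓ ∸ 1))
    λ[x+ℓ]≤k[λ-x[ℓ-1]] = subst (lam * (x + ℓ) ≤_) (sym (*-distribˡ-∸ k lam (x * L)))
      (m+n≤o⇒m≤o∸n (lam * (x + ℓ)) (begin
        lam * (x + ℓ) + k * (x * L)  ≡⟨ cong (lam * (x + ℓ) +_) (regroup k x L) ⟩
        lam * (x + ℓ) + x * (k * L)  ≤⟨ +-monoʳ-≤ (lam * (x + ℓ)) (*-monoʳ-≤ x (*-monoˡ-≤ L k≤r)) ⟩
        lam * (x + ℓ) + x * (r * L)  ≡⟨ cong (λ t → lam * (x + ℓ) + x * t) rL≡λC ⟩
        lam * (x + ℓ) + x * (lam * C) ≡⟨ regroup′ lam x C L ⟩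
        k * lam                      ∎))
      where
      open ≤-Reasoning
      regroup : ∀ k x L → k * (x * L) ≡ x * (k * L)
      regroup = solve-∀
      regroup′ : ∀ lam x C L → lam * (x + (1 + L)) + x * (lam * C) ≡ (x * (1 + C) + (1 + L)) * lam
      regroup′ = solve-∀

imprimitivity-parameters : ∀ {lam r k C D ℓ} → 1 ≤ lam → 1 ≤ C → 1 ≤ D →
  r * ℓ + lam ≡ r + lam * suc C → r * k + lam ≡ r + lam * (suc D * suc C) →
  Σ ℕ λ L → Σ ℕ λ x → ℓ ≡ suc L × k ≡ x * suc C + suc L × 1 ≤ L × 1 ≤ x ×
    r * L ≡ lam * C × r * x ≡ lam * D × suc D * L ≡ x * C + L
imprimitivity-parameters {lam} {r} {k} {C} {D} {ℓ} 1≤λ 1≤C 1≤D ℓ-count k-count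
  with balance-pos 1≤λ (s≤s 1≤C) ℓ-count | balance-pos 1≤λ (s≤s (≤-trans 1≤C (m≤m+n C (D * suc C)))) k-count
imprimitivity-parameters {lam} {r} {suc K} {C} {D} {suc L} 1≤λ 1≤C 1≤D ℓ-count k-count | s≤s z≤n | s≤s z≤n =
  L , x , refl , k≡xc+ℓ , 1≤L , 1≤x , rL≡λC , rx≡λD , dL≡xC+L
  where
  open ≡-Reasoning
  rL≡λC : r * L ≡ lam * C
  rL≡λC = cancel-pred r lam L C ℓ-count
  1≤rL : 1 ≤ r * L
  1≤rL = subst (1 ≤_) (sym rL≡λC) (*-mono-≤ 1≤λ 1≤C)
  1≤L : 1 ≤ L
  1≤L = 1≤m*n⇒1≤n r 1≤rL
  instance
    r≢0 : NonZero r
    r≢0 = >-nonZero (1≤m*n⇒1≤m 1≤rL)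
  rK≡r[dL]+λD : r * K ≡ r * (suc D * L) + lam * D
  rK≡r[dL]+λD = begin
    r * K                            ≡⟨ cancel-pred r lam K (C + D * suc C) k-count ⟩
    lam * (C + D * suc C)            ≡⟨ expand lam C D ⟩
    lam * C + D * (lam * C) + lam * D ≡⟨ cong (λ t → t + D * t + lam * D) rL≡λC ⟨
    r * L + D * (r * L) + lam * D    ≡⟨ collect r L D (lam * D) ⟩
    r * (suc D * L) + lam * D        ∎
    where
    expand : ∀ lam C D → lam * (C + D * (1 + C)) ≡ lam * C + D * (lam * C) + lam * D
    expand = solve-∀
    collect : ∀ r L D y → r * L + D * (r * L) + y ≡ r * ((1 + D) * L) + y
    collect = solve-∀
  dL≤K : suc D * L ≤ K
  dL≤K = *-cancelˡ-≤ r (subst (r * (suc D * L) ≤_) (sym rK≡r[dL]+λD) (m≤m+n _ (lam * D)))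
  x : ℕ
  x = proj₁ (m≤n⇒∃[o]m+o≡n dL≤K)
  dL+x≡K : suc D * L + x ≡ K
  dL+x≡K = proj₂ (m≤n⇒∃[o]m+o≡n dL≤K)
  rx≡λD : r * x ≡ lam * D
  rx≡λD = +-cancelˡ-≡ (r * (suc D * L)) (r * x) (lam * D)
    (trans (sym (*-distribˡ-+ r (suc D * L) x)) (trans (cong (r *_) dL+x≡K) rK≡r[dL]+λD))
  1≤x : 1 ≤ x
  1≤x = 1≤m*n⇒1≤n r (subst (1 ≤_) (sym rx≡λD) (*-mono-≤ 1≤λ 1≤D))
  dL≡xC+L : suc D * L ≡ x * C + L
  dL≡xC+L = *-cancelˡ-≡ (suc D * L) (x * C + L) r (begin
    r * (suc D * L)        ≡⟨ expand r D L ⟩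
    r * L + D * (r * L)    ≡⟨ cong (λ t → r * L + D * t) rL≡λC ⟩
    r * L + D * (lam * C)  ≡⟨ cong (r * L +_) (*-assoc′ D lam C) ⟩
    r * L + lam * D * C    ≡⟨ cong (λ t → r * L + t * C) rx≡λD ⟨
    r * L + r * x * C      ≡⟨ collect r L x C ⟩
    r * (x * C + L)        ∎)
    where
    expand : ∀ r D L → r * ((1 + D) * L) ≡ r * L + D * (r * L)
    expand = solve-∀
    *-assoc′ : ∀ D lam C → D * (lam * C) ≡ lam * D * C
    *-assoc′ = solve-∀
    collect : ∀ r L x C → r * L + r * x * C ≡ r * (x * C + L)
    collect = solve-∀
  k≡xc+ℓ : suc K ≡ x * suc C + suc L
  k≡xc+ℓ = trans (cong suc (trans (sym dL+x≡K) (cong (_+ x) dL≡xC+L))) (regroup x C L)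
    where
    regroup : ∀ x C L → 1 + (x * C + L + x) ≡ x * (1 + C) + (1 + L)
    regroup = solve-∀

imprimitivity-arithmetic : ∀ {lam r k b v c d ℓ} → 1 ≤ lam → 1 < c → 1 < d →
  r * ℓ + lam ≡ r + lam * c → r * k + lam ≡ r + lam * v → v ≡ d * c →
  b * k ≡ v * r → k ≤ r → ℓ ∣ k →
  Σ ℕ (λ x →
    x + d * (ℓ ∸ 1) + 1 ≡ k × 1 ≤ x ×
    2 ≤ lam ×
    (ℓ ∣ k × 1 < ℓ × ℓ < k) ×
    lam * (c ∸ 1) ≡ r * (ℓ ∸ 1) ×
    k ≡ x * c + ℓ ×
    r * x ≡ lam * (d ∸ 1) ×
    (Σ ℕ (λ q → lam * c * (c ∸ 1) * (k ∸ (x + 1)) ≡ q * (ℓ ∸ 1) ^ 2 × k ∣ q) ×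
      (ℓ ≡ 2 → k ∣ lam * c * (c ∸ 1) * (x + 1))) ×
    k ∣ lam * ℓ * (x + 1) * (x + ℓ) ×
    x * (ℓ ∸ 1) ≤ lam ∸ 1 ×
    lam + ℓ * (ℓ ∸ 1) ≤ c * (lam ∸ x * (ℓ ∸ 1)) ×
    lam * (x + ℓ) ≤ k * (lam ∸ x * (ℓ ∸ 1)))
imprimitivity-arithmetic {suc lam₀} {r} {k} {b} {v} {suc C} {suc D} {ℓ}
  1≤λ (s≤s 1≤C) (s≤s 1≤D) ℓ-count k-count refl bk≡vr k≤r ℓ∣k
  with imprimitivity-parameters 1≤λ 1≤C 1≤D ℓ-count k-count
... | L , x , refl , refl , 1≤L , 1≤x , rL≡λC , rx≡λD , dL≡xC+L =
  x , x+d[ℓ-1]+1≡k , 1≤x , ≤-trans (s≤s (*-mono-≤ 1≤x 1≤L)) (x[ℓ-1]<λ k≤r) ,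
  (ℓ∣k , s≤s 1≤L , ℓ<k 1≤x) , sym rL≡λC , refl , rx≡λD ,
  -- The case ℓ = 2 of (vi) holds for every ℓ.
  ((b * (x * suc C + suc L) , λc[c-1][k-x-1]≡bk[ℓ-1]² bk≡vr , n∣m*n b) , λ _ → k∣λc[c-1][x+1] bk≡vr) ,
  k∣λℓ[x+1][x+ℓ] bk≡vr , ≤-pred (x[ℓ-1]<λ k≤r) ,
  λ+ℓ[ℓ-1]≤c[λ-x[ℓ-1]] k≤r , λ[x+ℓ]≤k[λ-x[ℓ-1]] k≤r
  where open Imprimitivity {suc lam₀} {r} {b} {C} {D} {L} {x} rL≡λC rx≡λD dL≡xC+L hiding (c; d; ℓ; k)

lemma2p2 : (v k lam r b : ℕ) (B : Fin b → Subset v) →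
    IsNontrivial2Design v k lam B →
    (∀ p → replication B p ≡ r) →
    (G : Permutation v v → Set) → IsPermGroup G →
    (∀ g → G g → IsAutomorphism B g) →
    FlagTransitive B G →
    (c d : ℕ) (part : Fin v → Fin d) →
    IsPartitionInto d c part → 1 < c → 1 < d →
    Invariant G part →
    Σ ℕ (λ ℓ →
      (∀ i j → interSize part (B i) j ≢ 0 → interSize part (B i) j ≡ ℓ) ×
      Σ ℕ (λ x →
        x + d * (ℓ ∸ 1) + 1 ≡ k × 1 ≤ x ×
        2 ≤ lam ×
        (ℓ ∣ k × 1 < ℓ × ℓ < k) ×
        lam * (c ∸ 1) ≡ r * (ℓ ∸ 1) ×
        k ≡ x * c + ℓ ×
        r * x ≡ lam * (d ∸ 1) ×
        (Σ ℕ (λ q → lam * c * (c ∸ 1) * (k ∸ (x + 1)) ≡ q * (ℓ ∸ 1) ^ 2 × k ∣ q) ×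
          (ℓ ≡ 2 → k ∣ lam * c * (c ∸ 1) * (x + 1))) ×
        k ∣ lam * ℓ * (x + 1) * (x + ℓ) ×
        x * (ℓ ∸ 1) ≤ lam ∸ 1 ×
        lam + ℓ * (ℓ ∸ 1) ≤ c * (lam ∸ x * (ℓ ∸ 1)) ×
        lam * (x + ℓ) ≤ k * (lam ∸ x * (ℓ ∸ 1))))
lemma2p2 v k lam r b B D R G _ _ FT c d part P 1<c 1<d Inv =
  ℓ , constant ,
  imprimitivity-arithmetic {b = b} lam≥1 1<c 1<d (r[ℓ-1]≡λ[c-1] {part = part} P constant)
    r[k-1]≡λ[v-1] (Partition.v≡dc {part = part} P) bk≡vr k≤r (ℓ∣k {part = part} P constant)
  where
  open IsNontrivial2Design D using (lam≥1)
  open Design D R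
  ℓ : ℕ
  ℓ = interSize part (B i₀) (part p₀)
  constant : ∀ i j → interSize part (B i) j ≢ 0 → interSize part (B i) j ≡ ℓ
  constant = interSize-constant FT Inv p₀∈Bᵢ₀
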